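{- If $2 \leq t+1 < r < n$ are integers, then $l(\mathsf{P}_{n,r},t) \geq \frac{n-t-1}{r-t-1}\, l(\mathsf{P}_{n,r},t+1)$.
   Context: A partition of a set $X$ of length $r$ is a set $\{X_1,\dots,X_r\}$ of pairwise disjoint non-empty sets (parts) whose union is $X$; $\mathsf{P}_{n,r}$ is the family of all partitions of $[n]$ of length $r$ (each partition is a set of parts). For a family $\mathcal{F}$, $\mathcal{F}(T)=\{F\in\mathcal{F}:T\subseteq F\}$ and $l(\mathcal{F},q)=\max\{|\mathcal{F}(T)|:|T|=q\}$. -}

module Defs where

open import Data.Nat using (ℕ; _≤_)
open import Data.Fin using (Fin)
open import Data.Fin.Subset using (Subset; Nonempty; Empty; _∩_; ⋃; ⊤)
open import Data.List using (List; length)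
open import Data.List.Relation.Unary.All using (All)
open import Data.List.Relation.Unary.AllPairs using (AllPairs)
open import Data.List.Relation.Unary.Unique.Propositional using (Unique)
import Data.List.Membership.Propositional as LM
open import Data.List.Relation.Binary.Permutation.Propositional using (_↭_)
open import Data.Product using (Σ; ∃; _×_)
open import Relation.Binary.PropositionalEquality using (_≡_)
open import Level using (Level; _⊔_)

-- A finite set (of subsets of [n]) is represented by a duplicate-free list;
-- two such lists denote the same set iff they are permutations of each other.
FinSet : ℕ → Set
FinSet n = List (Subset n)

CountIs : ∀ {n} → (FinSet n → Set) → ℕ → Set
CountIs {n} P k =
  Σ (Fin k → FinSet n) λ f →
    ((i : Fin k) → P (f i)) ×
    ((i j : Fin k) → f i ↭ f j → i ≡ j) ×
    ((X : FinSet n) → P X → ∃ λ i → X ↭ f i)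

IsPartition : (n r : ℕ) → FinSet n → Set
IsPartition n r X =
  Unique X × length X ≡ r × All Nonempty X ×
  AllPairs (λ A B → Empty (A ∩ B)) X × ⋃ X ≡ ⊤

_⊆ₛ_ : ∀ {n} → FinSet n → FinSet n → Set
T ⊆ₛ F = All (λ A → A LM.∈ F) T

IsQSet : ∀ {n} → ℕ → FinSet n → Set
IsQSet q T = Unique T × length T ≡ q

CountPT : (n r : ℕ) → FinSet n → ℕ → Set
CountPT n r T k = CountIs (λ X → IsPartition n r X × T ⊆ₛ X) k

LIs : (n r q L : ℕ) → Set
LIs n r q L =
  (Σ (FinSet n) λ T → IsQSet q T × CountPT n r T L) ×
  ((T : FinSet n) → IsQSet q T → (k : ℕ) → CountPT n r T k → k ≤ L)

-- A partition of [n] containing a set T of q blocks is T together with a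
-- partition of the complement of ⋃ T into r − q blocks, so there are exactly
-- S(n − ∣⋃ T∣, r − q) of them, S being the Stirling numbers of the second kind.
-- As ∣⋃ T∣ ≥ q and S is monotone in its first argument, l(P_{n,r}, q) is
-- S(n − q, r − q), attained by T = {{1}, …, {q}}. The theorem thereby becomes
-- the inequality m S(m, j) ≤ j S(m + 1, j + 1) for m = n − t − 1 and
-- j = r − t − 1, which follows by induction on m from the recurrence of S.

module Submission where

open import Defs
open import Data.Nat using (ℕ; suc; _*_; _∸_; _≤_; _<_)
open import Data.Product using (∃₂; _×_)

open import Data.Nat using (zero; _+_; z≤n; s≤s)
open import Data.Nat.Properties
  using ( ≤-refl; ≤-trans; ≤-reflexive; <⇒≤; <-trans; n<1+n; m≤m+n; +-mono-≤; +-monoʳ-≤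
        ; *-monoʳ-≤; *-zeroʳ; +-suc; +-∸-assoc; m+n∸m≡n; m+[n∸m]≡n; ∸-monoʳ-≤; m≤n⇒m<n∨m≡n)
open import Data.Nat.Tactic.RingSolver using (solve-∀)
open import Data.Bool using (_∨_)
open import Data.Fin using (Fin; zero; suc; toℕ; fromℕ<; inject≤; splitAt; join; remQuot; combine)
import Data.Fin.Properties as Fin
open import Data.Fin.Subset
  using (Subset; Side; inside; outside; Nonempty; Empty; _∩_; _∪_; ⋃; ⊥; ∁; ⁅_⁆; _∈_; _∉_; ∣_∣)
import Data.Fin.Subset.Properties as Subset
open import Data.Vec using ([]; _∷_; here; there; head; tail)
open import Data.List using (List; []; _∷_; length; map; _++_; tabulate)
import Data.List.Properties as List
open import Data.List.Relation.Unary.All using (All; []; _∷_)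
import Data.List.Relation.Unary.All as All
import Data.List.Relation.Unary.All.Properties as All
open import Data.List.Relation.Unary.Any using (here; there)
open import Data.List.Relation.Unary.AllPairs using (AllPairs; []; _∷_)
import Data.List.Relation.Unary.AllPairs as AllPairs
import Data.List.Relation.Unary.AllPairs.Properties as AllPairs
open import Data.List.Relation.Unary.Unique.Propositional using (Unique)
import Data.List.Relation.Unary.Unique.Propositional.Properties as Unique
import Data.List.Membership.Propositional as Membership
import Data.List.Membership.Propositional.Properties as Membership
open import Data.List.Relation.Binary.Permutation.Propositional
  using (_↭_; refl; prep; swap; ↭-sym; ↭-trans; ↭-reflexive; ↭⇒↭ₛ; module PermutationReasoning)
open import Data.List.Relation.Binary.Permutation.Propositional.Properties
  using (All-resp-↭; ∈-resp-↭; ↭-length; map⁺; ++⁺ˡ; shift; drop-∷)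
import Data.List.Relation.Binary.Permutation.Setoid.Properties as Permutationₛ
open import Data.Maybe using (Maybe; just; nothing)
open import Data.Product using (∃; _,_; proj₁; proj₂)
open import Data.Sum using (_⊎_; inj₁; inj₂)
open import Data.Empty using (⊥-elim)
open import Function using (_∘_)
open import Relation.Binary using (Rel; Symmetric; _Respects_)
open import Relation.Nullary using (¬_; Dec; yes; no)
open import Relation.Binary.PropositionalEquality
  using (_≡_; _≢_; refl; sym; cong; cong₂; subst; subst₂; resp₂; setoid; module ≡-Reasoning)
  renaming (trans to ≡-trans)

-- Stirling numbers of the second kind

S : ℕ → ℕ → ℕ
S zero    zero    = 1
S zero    (suc k) = 0
S (suc N) zero    = 0
S (suc N) (suc k) = suc k * S N (suc k) + S N k

S[N,1+k]≤S[1+N,1+k] : ∀ N k → S N (suc k) ≤ S (suc N) (suc k)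
S[N,1+k]≤S[1+N,1+k] N k =
  ≤-trans (m≤m+n (S N (suc k)) (k * S N (suc k))) (m≤m+n (suc k * S N (suc k)) (S N k))

S-monoˡ-≤ : ∀ k {M N} → M ≤ N → S M (suc k) ≤ S N (suc k)
S-monoˡ-≤ k {N = zero} z≤n = ≤-refl
S-monoˡ-≤ k {N = suc N} M≤1+N with m≤n⇒m<n∨m≡n M≤1+N
... | inj₁ (s≤s M≤N) = ≤-trans (S-monoˡ-≤ k M≤N) (S[N,1+k]≤S[1+N,1+k] N k)
... | inj₂ refl      = ≤-refl

m*S[m,j]≤j*S[1+m,1+j] : ∀ m j → m * S m j ≤ j * S (suc m) (suc j)
m*S[m,j]≤j*S[1+m,1+j] zero    j       = z≤n
m*S[m,j]≤j*S[1+m,1+j] (suc m) zero    = ≤-reflexive (*-zeroʳ (suc m))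
m*S[m,j]≤j*S[1+m,1+j] (suc m) (suc j) = begin
  suc m * (J * y + x)                                             ≡⟨ expandˡ m j x y ⟩
  (J * y + x) + (J * (m * y) + m * x)                             ≤⟨ +-monoʳ-≤ (J * y + x) (+-mono-≤ IH₁ IH₂) ⟩
  (J * y + x) + (J * (J * (suc J * z + y)) + j * (J * y + x))     ≤⟨ m≤m+n _ (J * (suc J * z) + J * y) ⟩
  (J * y + x) + (J * (J * (suc J * z + y)) + j * (J * y + x))
    + (J * (suc J * z) + J * y)                                   ≡⟨ expandʳ j x y z ⟩
  J * (suc J * (suc J * z + y) + (J * y + x))                     ∎
  where
  open Data.Nat.Properties.≤-Reasoning
  J = suc j
  x = S m j
  y = S m J
  z = S m (suc J)
  IH₁ : J * (m * y) ≤ J * (J * (suc J * z + y))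
  IH₁ = *-monoʳ-≤ J (m*S[m,j]≤j*S[1+m,1+j] m J)
  IH₂ : m * x ≤ j * (J * y + x)
  IH₂ = m*S[m,j]≤j*S[1+m,1+j] m j
  expandˡ : ∀ a b c d → suc a * (suc b * d + c) ≡ (suc b * d + c) + (suc b * (a * d) + a * c)
  expandˡ = solve-∀
  expandʳ : ∀ b c d e →
    (suc b * d + c) + (suc b * (suc b * (suc (suc b) * e + d)) + b * (suc b * d + c))
      + (suc b * (suc (suc b) * e) + suc b * d)
    ≡ suc b * (suc (suc b) * (suc (suc b) * e + d) + (suc b * d + c))
  expandʳ = solve-∀

AllPairs-resp-↭ : ∀ {a r} {A : Set a} {R : Rel A r} → Symmetric R → (AllPairs R) Respects _↭_
AllPairs-resp-↭ {A = A} {R = R} R-sym p =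
  Permutationₛ.AllPairs-resp-↭ (setoid A) R-sym (resp₂ R) (↭⇒↭ₛ p)

Unique-resp-↭ : ∀ {a} {A : Set a} → Unique {A = A} Respects _↭_
Unique-resp-↭ {A = A} p = Permutationₛ.Unique-resp-↭ (setoid A) (↭⇒↭ₛ p)

AllPairs-++⁻ : ∀ {a r} {A : Set a} {R : Rel A r} xs {ys} → AllPairs R (xs ++ ys) →
  AllPairs R xs × AllPairs R ys × All (λ x → All (R x) ys) xs
AllPairs-++⁻ []       p        = [] , p , []
AllPairs-++⁻ (x ∷ xs) (px ∷ p) with AllPairs-++⁻ xs p
... | Rxs , Rys , Rxsys = All.++⁻ˡ xs px ∷ Rxs , Rys , All.++⁻ʳ xs px ∷ Rxsys

++-cancelˡ-↭ : ∀ {a} {A : Set a} (xs : List A) {ys zs} → xs ++ ys ↭ xs ++ zs → ys ↭ zs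
++-cancelˡ-↭ []       p = p
++-cancelˡ-↭ (x ∷ xs) p = ++-cancelˡ-↭ xs (drop-∷ p)

∈⇒↭∷ : ∀ {a} {A : Set a} {x : A} {xs} → x Membership.∈ xs → ∃ λ ys → xs ↭ x ∷ ys
∈⇒↭∷ {x = x} x∈xs with Membership.∈-∃++ x∈xs
... | ys , zs , refl = ys ++ zs , shift x ys zs

Unique-⊆⇒↭++ : ∀ {a} {A : Set a} {xs ys : List A} → Unique xs → All (Membership._∈ ys) xs →
  ∃ λ zs → ys ↭ xs ++ zs
Unique-⊆⇒↭++ {xs = []}     {ys} _            _          = ys , refl
Unique-⊆⇒↭++ {xs = x ∷ xs} (x∉xs ∷ xs-uniq) (x∈ys ∷ xs⊆ys) with ∈⇒↭∷ x∈ys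
... | ys′ , ys↭x∷ys′ with Unique-⊆⇒↭++ xs-uniq (All.tabulate λ y∈xs →
      ∈-other (∈-resp-↭ ys↭x∷ys′ (All.lookup xs⊆ys y∈xs)) (All.lookup x∉xs y∈xs))
  where
  ∈-other : ∀ {y zs} → y Membership.∈ x ∷ zs → x ≢ y → y Membership.∈ zs
  ∈-other (here y≡x) x≢y = ⊥-elim (x≢y (sym y≡x))
  ∈-other (there y∈zs) _ = y∈zs
... | zs , ys′↭xs++zs = zs , ↭-trans ys↭x∷ys′ (prep x ys′↭xs++zs)

_!_ : ∀ {a} {A : Set a} → List A → ℕ → Maybe A
[]       ! _     = nothing
(x ∷ xs) ! zero  = just x
(x ∷ xs) ! suc j = xs ! j

module _ {a} {A : Set a} where

  !-just⇒∈ : ∀ (xs : List A) j {x} → xs ! j ≡ just x → x Membership.∈ xs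
  !-just⇒∈ (y ∷ xs) zero    refl = here refl
  !-just⇒∈ (y ∷ xs) (suc j) e    = there (!-just⇒∈ xs j e)

  !-just⇒< : ∀ (xs : List A) j {x} → xs ! j ≡ just x → j < length xs
  !-just⇒< (y ∷ xs) zero    _ = s≤s z≤n
  !-just⇒< (y ∷ xs) (suc j) e = s≤s (!-just⇒< xs j e)

  <⇒!-just : ∀ (xs : List A) j → j < length xs → ∃ λ x → xs ! j ≡ just x
  <⇒!-just (y ∷ xs) zero    _         = y , refl
  <⇒!-just (y ∷ xs) (suc j) (s≤s j<n) = <⇒!-just xs j j<n

  ∈⇒!-just : ∀ {xs : List A} {x} → x Membership.∈ xs → ∃ λ j → xs ! j ≡ just x
  ∈⇒!-just (here refl) = zero , refl
  ∈⇒!-just (there x∈xs) with ∈⇒!-just x∈xs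
  ... | j , e = suc j , e

  Unique⇒!-injective : ∀ {xs : List A} → Unique xs → ∀ i j {x} →
    xs ! i ≡ just x → xs ! j ≡ just x → i ≡ j
  Unique⇒!-injective {y ∷ xs} _          zero    zero    _    _    = refl
  Unique⇒!-injective {y ∷ xs} (y∉xs ∷ _) zero    (suc j) refl e    =
    ⊥-elim (All.lookup y∉xs (!-just⇒∈ xs j e) refl)
  Unique⇒!-injective {y ∷ xs} (y∉xs ∷ _) (suc i) zero    e    refl =
    ⊥-elim (All.lookup y∉xs (!-just⇒∈ xs i e) refl)
  Unique⇒!-injective {y ∷ xs} (_ ∷ uniq) (suc i) (suc j) e    e′   =
    cong suc (Unique⇒!-injective uniq i j e e′)

Disjoint : ∀ {n} → Subset n → Subset n → Set
Disjoint A B = Empty (A ∩ B)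

module _ {n : ℕ} where

  Disjoint-sym : Symmetric (Disjoint {n})
  Disjoint-sym {A} {B} d (x , x∈B∩A) with Subset.x∈p∩q⁻ B A x∈B∩A
  ... | x∈B , x∈A = d (x , Subset.x∈p∩q⁺ (x∈A , x∈B))

  Disjoint-⊥ˡ : ∀ (B : Subset n) → Disjoint ⊥ B
  Disjoint-⊥ˡ B (x , x∈⊥∩B) = Subset.∉⊥ (proj₁ (Subset.x∈p∩q⁻ ⊥ B x∈⊥∩B))

  Nonempty-Disjoint⇒≢ : ∀ {A B : Subset n} → Nonempty A → Disjoint A B → A ≢ B
  Nonempty-Disjoint⇒≢ (x , x∈A) d refl = d (x , Subset.x∈p∩q⁺ (x∈A , x∈A))

  ∈-⋃⁺ : ∀ {x : Fin n} {A X} → x ∈ A → A Membership.∈ X → x ∈ ⋃ X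
  ∈-⋃⁺ x∈A (here refl)  = Subset.x∈p∪q⁺ (inj₁ x∈A)
  ∈-⋃⁺ x∈A (there A∈X) = Subset.x∈p∪q⁺ (inj₂ (∈-⋃⁺ x∈A A∈X))

  ∈-⋃⁻ : ∀ {x : Fin n} X → x ∈ ⋃ X → ∃ λ A → A Membership.∈ X × x ∈ A
  ∈-⋃⁻ []      x∈⊥ = ⊥-elim (Subset.∉⊥ x∈⊥)
  ∈-⋃⁻ (B ∷ X) x∈B∪⋃X with Subset.x∈p∪q⁻ B (⋃ X) x∈B∪⋃X
  ... | inj₁ x∈B  = B , here refl , x∈B
  ... | inj₂ x∈⋃X with ∈-⋃⁻ X x∈⋃X
  ...   | A , A∈X , x∈A = A , there A∈X , x∈A

  Disjoint-⋃ : ∀ {A : Subset n} {X} → All (Disjoint A) X → Disjoint A (⋃ X)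
  Disjoint-⋃ {A} {X} A#X (x , x∈A∩⋃X) with Subset.x∈p∩q⁻ A (⋃ X) x∈A∩⋃X
  ... | x∈A , x∈⋃X with ∈-⋃⁻ X x∈⋃X
  ...   | B , B∈X , x∈B = All.lookup A#X B∈X (x , Subset.x∈p∩q⁺ (x∈A , x∈B))

  ⋃-++ : ∀ (X Y : List (Subset n)) → ⋃ (X ++ Y) ≡ ⋃ X ∪ ⋃ Y
  ⋃-++ []      Y = sym (Subset.∪-identityˡ (⋃ Y))
  ⋃-++ (A ∷ X) Y = ≡-trans (cong (A ∪_) (⋃-++ X Y)) (sym (Subset.∪-assoc A (⋃ X) (⋃ Y)))

  ⋃-↭ : ∀ {X Y : List (Subset n)} → X ↭ Y → ⋃ X ≡ ⋃ Y
  ⋃-↭ p = Permutationₛ.foldr-commMonoid (setoid (Subset n)) (Subset.∪-isCommutativeMonoid n) (↭⇒↭ₛ p)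

⁅⁆-injective : ∀ {n} {x y : Fin n} → ⁅ x ⁆ ≡ ⁅ y ⁆ → x ≡ y
⁅⁆-injective {x = x} {y} eq = Subset.x∈⁅y⁆⇒x≡y y (subst (x ∈_) eq (Subset.x∈⁅x⁆ x))

≢⇒Disjoint-⁅⁆ : ∀ {n} {x y : Fin n} → x ≢ y → Disjoint ⁅ x ⁆ ⁅ y ⁆
≢⇒Disjoint-⁅⁆ {x = x} {y} x≢y (z , z∈x∩y) with Subset.x∈p∩q⁻ ⁅ x ⁆ ⁅ y ⁆ z∈x∩y
... | z∈x , z∈y = x≢y (≡-trans (sym (Subset.x∈⁅y⁆⇒x≡y x z∈x)) (Subset.x∈⁅y⁆⇒x≡y y z∈y))

Disjoint-tail : ∀ {n} a b {A B : Subset n} → Disjoint (a ∷ A) (b ∷ B) → Disjoint A B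
Disjoint-tail _ _ d (x , x∈A∩B) = d (suc x , there x∈A∩B)

Disjoint-outside⁺ : ∀ {n} a {A B : Subset n} → Disjoint A B → Disjoint (a ∷ A) (outside ∷ B)
Disjoint-outside⁺ inside  d (zero , ())
Disjoint-outside⁺ outside d (zero , ())
Disjoint-outside⁺ _       d (suc x , there x∈A∩B) = d (x , x∈A∩B)

¬Disjoint-inside : ∀ {n} {A B : Subset n} → ¬ Disjoint (inside ∷ A) (inside ∷ B)
¬Disjoint-inside d = d (zero , here)

Nonempty-outside⁺ : ∀ {n} {A : Subset n} → Nonempty A → Nonempty (outside ∷ A)
Nonempty-outside⁺ (x , x∈A) = suc x , there x∈A

Nonempty-outside⁻ : ∀ {n} {A : Subset n} → Nonempty (outside ∷ A) → Nonempty A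
Nonempty-outside⁻ (suc x , there x∈A) = x , x∈A

Nonempty⇒0<∣p∣ : ∀ {n} {p : Subset n} → Nonempty p → 0 < ∣ p ∣
Nonempty⇒0<∣p∣ {p = inside  ∷ p} _  = s≤s z≤n
Nonempty⇒0<∣p∣ {p = outside ∷ p} ne = Nonempty⇒0<∣p∣ (Nonempty-outside⁻ ne)

Disjoint⇒∣p∪q∣≡∣p∣+∣q∣ : ∀ {n} (p q : Subset n) → Disjoint p q → ∣ p ∪ q ∣ ≡ ∣ p ∣ + ∣ q ∣
Disjoint⇒∣p∪q∣≡∣p∣+∣q∣ []            []            _ = refl
Disjoint⇒∣p∪q∣≡∣p∣+∣q∣ (inside  ∷ p) (inside  ∷ q) d = ⊥-elim (¬Disjoint-inside d)
Disjoint⇒∣p∪q∣≡∣p∣+∣q∣ (inside  ∷ p) (outside ∷ q) d =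
  cong suc (Disjoint⇒∣p∪q∣≡∣p∣+∣q∣ p q (Disjoint-tail inside outside d))
Disjoint⇒∣p∪q∣≡∣p∣+∣q∣ (outside ∷ p) (inside  ∷ q) d =
  ≡-trans (cong suc (Disjoint⇒∣p∪q∣≡∣p∣+∣q∣ p q (Disjoint-tail outside inside d)))
          (sym (+-suc ∣ p ∣ ∣ q ∣))
Disjoint⇒∣p∪q∣≡∣p∣+∣q∣ (outside ∷ p) (outside ∷ q) d =
  Disjoint⇒∣p∪q∣≡∣p∣+∣q∣ p q (Disjoint-tail outside outside d)

-- Partitions of a subset

IsPartitionOf : ∀ {n} → Subset n → ℕ → FinSet n → Set
IsPartitionOf C k X = Unique X × length X ≡ k × All Nonempty X × AllPairs Disjoint X × ⋃ X ≡ C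

IsPartitionOf-resp-↭ : ∀ {n} {C : Subset n} {k X Y} → X ↭ Y → IsPartitionOf C k X → IsPartitionOf C k Y
IsPartitionOf-resp-↭ p (uniq , len , ne , disj , ⋃≡C) =
  Unique-resp-↭ p uniq , ≡-trans (sym (↭-length p)) len , All-resp-↭ p ne ,
  AllPairs-resp-↭ Disjoint-sym p disj , ≡-trans (sym (⋃-↭ p)) ⋃≡C

extendOut : ∀ {n} → FinSet n → FinSet (suc n)
extendOut = map (outside ∷_)

dropZero : ∀ {n} → FinSet (suc n) → FinSet n
dropZero = map tail

containsZero : ∀ {n} → FinSet (suc n) → Side
containsZero []            = outside
containsZero ((a ∷ _) ∷ X) = a ∨ containsZero X

⋃-extendOut : ∀ {n} (Y : FinSet n) → ⋃ (extendOut Y) ≡ outside ∷ ⋃ Y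
⋃-extendOut []      = refl
⋃-extendOut (A ∷ Y) = cong ((outside ∷ A) ∪_) (⋃-extendOut Y)

⋃-dropZero : ∀ {n} (X : FinSet (suc n)) → ⋃ X ≡ containsZero X ∷ ⋃ (dropZero X)
⋃-dropZero []            = refl
⋃-dropZero ((a ∷ A) ∷ X) = cong ((a ∷ A) ∪_) (⋃-dropZero X)

dropZero-extendOut : ∀ {n} (Y : FinSet n) → dropZero (extendOut Y) ≡ Y
dropZero-extendOut []      = refl
dropZero-extendOut (A ∷ Y) = cong (A ∷_) (dropZero-extendOut Y)

extendOut-cancel-↭ : ∀ {n} {Y Y′ : FinSet n} → extendOut Y ↭ extendOut Y′ → Y ↭ Y′
extendOut-cancel-↭ {Y = Y} {Y′} p =
  subst₂ _↭_ (dropZero-extendOut Y) (dropZero-extendOut Y′) (map⁺ tail p)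

All-outside⇒≡extendOut : ∀ {n} {X : FinSet (suc n)} →
  All (λ A → head A ≡ outside) X → X ≡ extendOut (dropZero X)
All-outside⇒≡extendOut                         []         = refl
All-outside⇒≡extendOut {X = (outside ∷ A) ∷ X} (refl ∷ p) =
  cong ((outside ∷ A) ∷_) (All-outside⇒≡extendOut p)

containsZero≡outside⇒All : ∀ {n} (X : FinSet (suc n)) → containsZero X ≡ outside →
  All (λ A → head A ≡ outside) X
containsZero≡outside⇒All []                  _ = []
containsZero≡outside⇒All ((outside ∷ A) ∷ X) e = refl ∷ containsZero≡outside⇒All X e

containsZero≡inside⇒∈ : ∀ {n} (X : FinSet (suc n)) → containsZero X ≡ inside →
  ∃ λ B → (inside ∷ B) Membership.∈ X
containsZero≡inside⇒∈ ((inside  ∷ A) ∷ X) _ = A , here refl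
containsZero≡inside⇒∈ ((outside ∷ A) ∷ X) e with containsZero≡inside⇒∈ X e
... | B , B∈X = B , there B∈X

inside∉extendOut : ∀ {n} {A : Subset n} (Y : FinSet n) → ¬ (inside ∷ A) Membership.∈ extendOut Y
inside∉extendOut (B ∷ Y) (there A∈Y) = inside∉extendOut Y A∈Y

inside-∈-zeroBlock : ∀ {n} {A B : Subset n} {Y} →
  (inside ∷ A) Membership.∈ ((inside ∷ B) ∷ extendOut Y) → A ≡ B
inside-∈-zeroBlock         (here A≡B)  = cong tail A≡B
inside-∈-zeroBlock {Y = Y} (there A∈Y) = ⊥-elim (inside∉extendOut Y A∈Y)

Disjoint-inside⇒head≡outside : ∀ {n} {B : Subset n} (A : Subset (suc n)) →
  Disjoint (inside ∷ B) A → head A ≡ outside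
Disjoint-inside⇒head≡outside (outside ∷ A) _ = refl
Disjoint-inside⇒head≡outside (inside  ∷ A) d = ⊥-elim (¬Disjoint-inside d)

IsPartitionOf-extendOut⁺ : ∀ {n} {C : Subset n} {k Y} →
  IsPartitionOf C k Y → IsPartitionOf (outside ∷ C) k (extendOut Y)
IsPartitionOf-extendOut⁺ {Y = Y} (uniq , len , ne , disj , ⋃≡C) =
  Unique.map⁺ (cong tail) uniq , ≡-trans (List.length-map _ Y) len ,
  All.map⁺ (All.map Nonempty-outside⁺ ne) , AllPairs.map⁺ (AllPairs.map (Disjoint-outside⁺ outside) disj) ,
  ≡-trans (⋃-extendOut Y) (cong (outside ∷_) ⋃≡C)

IsPartitionOf-extendOut⁻ : ∀ {n} {C : Subset n} {k Y} →
  IsPartitionOf (outside ∷ C) k (extendOut Y) → IsPartitionOf C k Y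
IsPartitionOf-extendOut⁻ {Y = Y} (uniq , len , ne , disj , ⋃≡) =
  Unique.map⁻ uniq , ≡-trans (sym (List.length-map _ Y)) len ,
  All.map Nonempty-outside⁻ (All.map⁻ ne) , AllPairs.map (Disjoint-tail outside outside) (AllPairs.map⁻ disj) ,
  cong tail (≡-trans (sym (⋃-extendOut Y)) ⋃≡)

IsPartitionOf-outside⁻ : ∀ {n} {C : Subset n} {k X} →
  IsPartitionOf (outside ∷ C) k X → ∃ λ Y → X ≡ extendOut Y × IsPartitionOf C k Y
IsPartitionOf-outside⁻ {X = X} P@(_ , _ , _ , _ , ⋃≡) =
  dropZero X , X≡ , IsPartitionOf-extendOut⁻ (subst (IsPartitionOf _ _) X≡ P)
  where
  X≡ : X ≡ extendOut (dropZero X)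
  X≡ = All-outside⇒≡extendOut (containsZero≡outside⇒All X (cong head (≡-trans (sym (⋃-dropZero X)) ⋃≡)))

IsPartitionOf-inside⁻ : ∀ {n} {C : Subset n} {k X} →
  IsPartitionOf (inside ∷ C) k X → ∃₂ λ B Y → X ↭ (inside ∷ B) ∷ extendOut Y
IsPartitionOf-inside⁻ {X = X} (_ , _ , _ , disj , ⋃≡)
  with containsZero≡inside⇒∈ X (cong head (≡-trans (sym (⋃-dropZero X)) ⋃≡))
... | B , B∈X with ∈⇒↭∷ B∈X
... | X′ , X↭B∷X′ with AllPairs-resp-↭ Disjoint-sym X↭B∷X′ disj
... | B#X′ ∷ _ = B , dropZero X′ ,
  ↭-trans X↭B∷X′ (prep _ (↭-reflexive
    (All-outside⇒≡extendOut (All.map (λ {A} → Disjoint-inside⇒head≡outside A) B#X′))))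

IsPartitionOf-zeroBlock⁺ : ∀ {n} {C B : Subset n} {k Y} → All (Disjoint B) Y → B ∪ ⋃ Y ≡ C →
  Unique Y → All Nonempty Y → AllPairs Disjoint Y → suc (length Y) ≡ k →
  IsPartitionOf (inside ∷ C) k ((inside ∷ B) ∷ extendOut Y)
IsPartitionOf-zeroBlock⁺ {B = B} {Y = Y} B#Y B∪⋃Y≡C uniq ne disj len =
  All.map⁺ (All.universal (λ _ ()) Y) ∷ Unique.map⁺ (cong tail) uniq ,
  ≡-trans (cong suc (List.length-map _ Y)) len ,
  (zero , here) ∷ All.map⁺ (All.map Nonempty-outside⁺ ne) ,
  All.map⁺ (All.map (Disjoint-outside⁺ inside) B#Y) ∷ AllPairs.map⁺ (AllPairs.map (Disjoint-outside⁺ outside) disj) ,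
  ≡-trans (cong ((inside ∷ B) ∪_) (⋃-extendOut Y)) (cong (inside ∷_) B∪⋃Y≡C)

IsPartitionOf-singleton⁺ : ∀ {n} {C : Subset n} {k Y} →
  IsPartitionOf C k Y → IsPartitionOf (inside ∷ C) (suc k) ((inside ∷ ⊥) ∷ extendOut Y)
IsPartitionOf-singleton⁺ {Y = Y} (uniq , len , ne , disj , ⋃≡C) =
  IsPartitionOf-zeroBlock⁺ (All.universal Disjoint-⊥ˡ Y) (≡-trans (Subset.∪-identityˡ (⋃ Y)) ⋃≡C)
    uniq ne disj (cong suc len)

IsPartitionOf-joinBlock⁺ : ∀ {n} {C B : Subset n} {k Y} →
  IsPartitionOf C k (B ∷ Y) → IsPartitionOf (inside ∷ C) k ((inside ∷ B) ∷ extendOut Y)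
IsPartitionOf-joinBlock⁺ ((_ ∷ uniq) , len , (_ ∷ ne) , (B#Y ∷ disj) , ⋃≡C) =
  IsPartitionOf-zeroBlock⁺ B#Y ⋃≡C uniq ne disj len

IsPartitionOf-zeroBlock⁻ : ∀ {n} {C B : Subset n} {k Y} →
  IsPartitionOf (inside ∷ C) k ((inside ∷ B) ∷ extendOut Y) →
  (Empty B × ∃ λ k′ → k ≡ suc k′ × IsPartitionOf C k′ Y) ⊎ (Nonempty B × IsPartitionOf C k (B ∷ Y))
IsPartitionOf-zeroBlock⁻ {C = C} {B} {k} {Y} ((_ ∷ uniq) , len , (_ ∷ ne) , (B#Y ∷ disj) , ⋃≡) =
  cases (Subset.nonempty? B)
  where
  uniq′ = Unique.map⁻ uniq
  ne′ = All.map Nonempty-outside⁻ (All.map⁻ ne)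
  disj′ = AllPairs.map (Disjoint-tail outside outside) (AllPairs.map⁻ disj)
  B#Y′ : All (Disjoint B) Y
  B#Y′ = All.map (Disjoint-tail inside outside) (All.map⁻ B#Y)
  B∪⋃Y≡C : B ∪ ⋃ Y ≡ C
  B∪⋃Y≡C = cong tail (≡-trans (sym (cong ((inside ∷ B) ∪_) (⋃-extendOut Y))) ⋃≡)
  cases : Dec (Nonempty B) →
    (Empty B × ∃ λ k′ → k ≡ suc k′ × IsPartitionOf C k′ Y) ⊎ (Nonempty B × IsPartitionOf C k (B ∷ Y))
  cases (no B-empty) = inj₁ (B-empty , length Y , ≡-trans (sym len) (cong suc (List.length-map _ Y)) ,
    uniq′ , refl , ne′ , disj′ ,
    ≡-trans (sym (Subset.∪-identityˡ (⋃ Y)))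
            (subst (λ A → A ∪ ⋃ Y ≡ C) (Subset.Empty-unique B-empty) B∪⋃Y≡C))
  cases (yes B-ne) = inj₂ (B-ne , All.map (Nonempty-Disjoint⇒≢ B-ne) B#Y′ ∷ uniq′ ,
    ≡-trans (cong suc (sym (List.length-map _ Y))) len , B-ne ∷ ne′ , B#Y′ ∷ disj′ , B∪⋃Y≡C)

insertZeroAt : ∀ {n} → ℕ → FinSet n → FinSet (suc n)
insertZeroAt _       []      = []
insertZeroAt zero    (B ∷ E) = (inside ∷ B) ∷ extendOut E
insertZeroAt (suc j) (B ∷ E) = (outside ∷ B) ∷ insertZeroAt j E

dropZero-insertZeroAt : ∀ {n} j (E : FinSet n) → dropZero (insertZeroAt j E) ≡ E
dropZero-insertZeroAt _       []      = refl
dropZero-insertZeroAt zero    (B ∷ E) = cong (B ∷_) (dropZero-extendOut E)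
dropZero-insertZeroAt (suc j) (B ∷ E) = cong (B ∷_) (dropZero-insertZeroAt j E)

insertZeroAt-↭ : ∀ {n} (E : FinSet n) j {B} → E ! j ≡ just B →
  ∃ λ E′ → E ↭ B ∷ E′ × insertZeroAt j E ↭ (inside ∷ B) ∷ extendOut E′
insertZeroAt-↭ (B ∷ E) zero    refl = E , refl , refl
insertZeroAt-↭ (A ∷ E) (suc j) {B} E!j with insertZeroAt-↭ E j E!j
... | E′ , E↭B∷E′ , ins↭ = A ∷ E′ , ↭-trans (prep A E↭B∷E′) (swap A B refl) ,
  ↭-trans (prep _ ins↭) (swap _ _ refl)

insertZeroAt-isPartitionOf : ∀ {n} {C : Subset n} {k E} j → j < k →
  IsPartitionOf C k E → IsPartitionOf (inside ∷ C) k (insertZeroAt j E)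
insertZeroAt-isPartitionOf {E = E} j j<k P@(_ , len , _) with <⇒!-just E j (subst (j <_) (sym len) j<k)
... | B , E!j with insertZeroAt-↭ E j E!j
... | E′ , E↭B∷E′ , ins↭ =
  IsPartitionOf-resp-↭ (↭-sym ins↭) (IsPartitionOf-joinBlock⁺ (IsPartitionOf-resp-↭ E↭B∷E′ P))

insertZeroAt-injective : ∀ {n} {E : FinSet n} → Unique E → ∀ {i j} → i < length E → j < length E →
  insertZeroAt i E ↭ insertZeroAt j E → i ≡ j
insertZeroAt-injective {E = E} uniq {i} {j} i< j< p with <⇒!-just E i i< | <⇒!-just E j j<
... | B , E!i | B′ , E!j with insertZeroAt-↭ E i E!i | insertZeroAt-↭ E j E!j
... | _ , _ , insᵢ↭ | _ , _ , insⱼ↭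
  with inside-∈-zeroBlock (∈-resp-↭ insⱼ↭ (∈-resp-↭ p (∈-resp-↭ (↭-sym insᵢ↭) (here refl))))
... | refl = Unique⇒!-injective uniq i j E!i E!j

insertZeroAt-surjective : ∀ {n} {B : Subset n} {Y E} → B ∷ Y ↭ E →
  ∃ λ j → j < length E × (inside ∷ B) ∷ extendOut Y ↭ insertZeroAt j E
insertZeroAt-surjective {E = E} B∷Y↭E with ∈⇒!-just (∈-resp-↭ B∷Y↭E (here refl))
... | j , E!j with insertZeroAt-↭ E j E!j
... | E′ , E↭B∷E′ , ins↭ = j , !-just⇒< E j E!j ,
  ↭-trans (prep _ (map⁺ (outside ∷_) (drop-∷ (↭-trans B∷Y↭E E↭B∷E′)))) (↭-sym ins↭)

¬insertZeroAt↭singleton : ∀ {n} {E F : FinSet n} {j} → All Nonempty E → j < length E →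
  ¬ (insertZeroAt j E ↭ (inside ∷ ⊥) ∷ extendOut F)
¬insertZeroAt↭singleton {E = E} {j = j} ne j< p with <⇒!-just E j j<
... | B , E!j with insertZeroAt-↭ E j E!j
... | _ , _ , ins↭ with All.lookup ne (!-just⇒∈ E j E!j)
... | x , x∈B =
  Subset.∉⊥ (subst (x ∈_) (inside-∈-zeroBlock (∈-resp-↭ p (∈-resp-↭ (↭-sym ins↭) (here refl)))) x∈B)

-- The enumeration follows S(N + 1, k + 1) = (k + 1) S(N, k + 1) + S(N, k):
-- a partition of {0} ∪ C into k + 1 blocks adds 0 to one of the k + 1 blocks
-- of a partition of C, or adds the block {0} to a partition of C into k blocks.
mutual
  partition : ∀ {n} (C : Subset n) k → Fin (S ∣ C ∣ k) → FinSet n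
  partition []            zero    _ = []
  partition (outside ∷ C) k       i = extendOut (partition C k i)
  partition (inside  ∷ C) (suc k) i = partitionWithZero C k (splitAt (suc k * S ∣ C ∣ (suc k)) i)

  partitionWithZero : ∀ {n} (C : Subset n) k →
    Fin (suc k * S ∣ C ∣ (suc k)) ⊎ Fin (S ∣ C ∣ k) → FinSet (suc n)
  partitionWithZero C k (inj₁ i) = joinZero C k (remQuot (S ∣ C ∣ (suc k)) i)
  partitionWithZero C k (inj₂ i) = (inside ∷ ⊥) ∷ extendOut (partition C k i)

  joinZero : ∀ {n} (C : Subset n) k → Fin (suc k) × Fin (S ∣ C ∣ (suc k)) → FinSet (suc n)
  joinZero C k (j , i) = insertZeroAt (toℕ j) (partition C (suc k) i)

mutual
  partition-isPartitionOf : ∀ {n} (C : Subset n) k i → IsPartitionOf C k (partition C k i)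
  partition-isPartitionOf []            zero    _ = [] , refl , [] , [] , refl
  partition-isPartitionOf (outside ∷ C) k       i = IsPartitionOf-extendOut⁺ (partition-isPartitionOf C k i)
  partition-isPartitionOf (inside  ∷ C) (suc k) i with splitAt (suc k * S ∣ C ∣ (suc k)) i
  ... | inj₁ i′ = joinZero-isPartitionOf C k (remQuot (S ∣ C ∣ (suc k)) i′)
  ... | inj₂ i′ = IsPartitionOf-singleton⁺ (partition-isPartitionOf C k i′)

  joinZero-isPartitionOf : ∀ {n} (C : Subset n) k p → IsPartitionOf (inside ∷ C) (suc k) (joinZero C k p)
  joinZero-isPartitionOf C k (j , i) =
    insertZeroAt-isPartitionOf (toℕ j) (Fin.toℕ<n j) (partition-isPartitionOf C (suc k) i)

toℕ<length : ∀ {n} {C : Subset n} {k E} → IsPartitionOf C k E → (j : Fin k) → toℕ j < length E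
toℕ<length (_ , len , _) j = subst (toℕ j <_) (sym len) (Fin.toℕ<n j)

splitAt-injective : ∀ m {n} {i j : Fin (m + n)} → splitAt m i ≡ splitAt m j → i ≡ j
splitAt-injective m {n} {i} {j} eq =
  ≡-trans (sym (Fin.join-splitAt m n i)) (≡-trans (cong (join m n) eq) (Fin.join-splitAt m n j))

remQuot-injective : ∀ {m} n {i j : Fin (m * n)} → remQuot n i ≡ remQuot n j → i ≡ j
remQuot-injective {m} n {i} {j} eq =
  ≡-trans (sym (Fin.combine-remQuot {m} n i))
    (≡-trans (cong (λ (p : Fin m × Fin n) → combine (proj₁ p) (proj₂ p)) eq) (Fin.combine-remQuot {m} n j))

mutual
  partition-injective : ∀ {n} (C : Subset n) k {i i′} → partition C k i ↭ partition C k i′ → i ≡ i′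
  partition-injective []            zero    {zero} {zero} _ = refl
  partition-injective (outside ∷ C) k       p = partition-injective C k (extendOut-cancel-↭ p)
  partition-injective (inside  ∷ C) (suc k) p =
    splitAt-injective (suc k * S ∣ C ∣ (suc k)) (partitionWithZero-injective C k p)

  partitionWithZero-injective : ∀ {n} (C : Subset n) k {s s′} →
    partitionWithZero C k s ↭ partitionWithZero C k s′ → s ≡ s′
  partitionWithZero-injective C k {inj₁ i} {inj₁ i′} p =
    cong inj₁ (remQuot-injective {suc k} (S ∣ C ∣ (suc k)) (joinZero-injective C k p))
  partitionWithZero-injective C k {inj₂ i} {inj₂ i′} p =
    cong inj₂ (partition-injective C k (extendOut-cancel-↭ (drop-∷ p)))
  partitionWithZero-injective C k {inj₁ i} {inj₂ i′} p = ⊥-elim (joinZero≭singleton C k _ p)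
  partitionWithZero-injective C k {inj₂ i} {inj₁ i′} p = ⊥-elim (joinZero≭singleton C k _ (↭-sym p))

  joinZero-injective : ∀ {n} (C : Subset n) k {p p′} → joinZero C k p ↭ joinZero C k p′ → p ≡ p′
  joinZero-injective C k {j , i} {j′ , i′} q
    with partition-injective C (suc k)
      (subst₂ _↭_ (dropZero-insertZeroAt (toℕ j) _) (dropZero-insertZeroAt (toℕ j′) _) (map⁺ tail q))
  ... | refl = cong (_, i) (Fin.toℕ-injective
    (insertZeroAt-injective (proj₁ P) (toℕ<length P j) (toℕ<length P j′) q))
    where P = partition-isPartitionOf C (suc k) i

  joinZero≭singleton : ∀ {n} (C : Subset n) k p {F} → ¬ (joinZero C k p ↭ (inside ∷ ⊥) ∷ extendOut F)
  joinZero≭singleton C k (j , i) =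
    ¬insertZeroAt↭singleton (proj₁ (proj₂ (proj₂ P))) (toℕ<length P j)
    where P = partition-isPartitionOf C (suc k) i

partition-join-inj₁ : ∀ {n} (C : Subset n) k j i →
  partition (inside ∷ C) (suc k) (join (suc k * S ∣ C ∣ (suc k)) (S ∣ C ∣ k) (inj₁ (combine j i))) ≡
  insertZeroAt (toℕ j) (partition C (suc k) i)
partition-join-inj₁ C k j i =
  ≡-trans (cong (partitionWithZero C k) (Fin.splitAt-join (suc k * S ∣ C ∣ (suc k)) (S ∣ C ∣ k) (inj₁ (combine j i))))
          (cong (joinZero C k) (Fin.remQuot-combine j i))

partition-join-inj₂ : ∀ {n} (C : Subset n) k i →
  partition (inside ∷ C) (suc k) (join (suc k * S ∣ C ∣ (suc k)) (S ∣ C ∣ k) (inj₂ i)) ≡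
  (inside ∷ ⊥) ∷ extendOut (partition C k i)
partition-join-inj₂ C k i =
  cong (partitionWithZero C k) (Fin.splitAt-join (suc k * S ∣ C ∣ (suc k)) (S ∣ C ∣ k) (inj₂ i))

partition-surjective : ∀ {n} (C : Subset n) k X → IsPartitionOf C k X → ∃ λ i → X ↭ partition C k i
partition-surjective []            zero    []      _                            = zero , refl
partition-surjective []            (suc k) []      (_ , () , _)
partition-surjective []            k       (A ∷ X) (_ , _ , (() , _) ∷ _ , _)
partition-surjective (outside ∷ C) k       X       P with IsPartitionOf-outside⁻ P
... | Y , refl , PY with partition-surjective C k Y PY
... | i , Y↭ = i , map⁺ (outside ∷_) Y↭
partition-surjective (inside ∷ C)  zero    []      (_ , _ , _ , _ , ())
partition-surjective (inside ∷ C)  zero    (A ∷ X) (_ , () , _)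
partition-surjective (inside ∷ C)  (suc k) X       P with IsPartitionOf-inside⁻ P
... | B , Y , X↭ with IsPartitionOf-zeroBlock⁻ (IsPartitionOf-resp-↭ X↭ P)
... | inj₁ (B-empty , k′ , refl , PY) with partition-surjective C k′ Y PY
...   | i , Y↭ = join _ _ (inj₂ i) , (begin
  X                                          ↭⟨ X↭ ⟩
  (inside ∷ B) ∷ extendOut Y                 ≡⟨ cong (λ A → (inside ∷ A) ∷ extendOut Y) (Subset.Empty-unique B-empty) ⟩
  (inside ∷ ⊥) ∷ extendOut Y                 ↭⟨ prep _ (map⁺ (outside ∷_) Y↭) ⟩
  (inside ∷ ⊥) ∷ extendOut (partition C k′ i) ≡⟨ partition-join-inj₂ C k′ i ⟨
  partition (inside ∷ C) (suc k′) (join _ _ (inj₂ i)) ∎)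
  where open PermutationReasoning
partition-surjective (inside ∷ C)  (suc k) X       P | B , Y , X↭ | inj₂ (B-ne , PBY)
  with partition-surjective C (suc k) (B ∷ Y) PBY
... | i , B∷Y↭ with insertZeroAt-surjective B∷Y↭
... | j , j< , ↭ins = join _ _ (inj₁ (combine (fromℕ< j<′) i)) , (begin
  X                                                 ↭⟨ X↭ ⟩
  (inside ∷ B) ∷ extendOut Y                        ↭⟨ ↭ins ⟩
  insertZeroAt j (partition C (suc k) i)            ≡⟨ cong (λ j → insertZeroAt j _) (Fin.toℕ-fromℕ< j<′) ⟨
  insertZeroAt (toℕ (fromℕ< j<′)) (partition C (suc k) i) ≡⟨ partition-join-inj₁ C k (fromℕ< j<′) i ⟨
  partition (inside ∷ C) (suc k) (join _ _ (inj₁ (combine (fromℕ< j<′) i))) ∎)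
  where
  open PermutationReasoning
  j<′ : j < suc k
  j<′ = subst (j <_) (proj₁ (proj₂ (partition-isPartitionOf C (suc k) i))) j<

countPartitionsOf : ∀ {n} (C : Subset n) k → CountIs (IsPartitionOf C k) (S ∣ C ∣ k)
countPartitionsOf C k =
  partition C k , partition-isPartitionOf C k , (λ _ _ → partition-injective C k) , partition-surjective C k

-- Partitions of [n] containing given blocks

IsPartialPartition : ∀ {n} → FinSet n → Set
IsPartialPartition T = Unique T × All Nonempty T × AllPairs Disjoint T

length≤∣⋃∣ : ∀ {n} {T : FinSet n} → IsPartialPartition T → length T ≤ ∣ ⋃ T ∣
length≤∣⋃∣ {T = []}    _ = z≤n
length≤∣⋃∣ {T = A ∷ T} (_ ∷ uniq , ne-A ∷ ne , A#T ∷ disj) = begin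
  suc (length T)    ≤⟨ +-mono-≤ (Nonempty⇒0<∣p∣ ne-A) (length≤∣⋃∣ (uniq , ne , disj)) ⟩
  ∣ A ∣ + ∣ ⋃ T ∣   ≡⟨ Disjoint⇒∣p∪q∣≡∣p∣+∣q∣ A (⋃ T) (Disjoint-⋃ A#T) ⟨
  ∣ A ∪ ⋃ T ∣       ∎
  where open Data.Nat.Properties.≤-Reasoning

∣⋃∣≡length : ∀ {n} {T : FinSet n} → AllPairs Disjoint T → All (λ A → ∣ A ∣ ≡ 1) T → ∣ ⋃ T ∣ ≡ length T
∣⋃∣≡length {n} {[]}    _            _ = Subset.∣⊥∣≡0 n
∣⋃∣≡length {T = A ∷ T} (A#T ∷ disj) (∣A∣≡1 ∷ ∣T∣≡1) =
  ≡-trans (Disjoint⇒∣p∪q∣≡∣p∣+∣q∣ A (⋃ T) (Disjoint-⋃ A#T))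
          (cong₂ _+_ ∣A∣≡1 (∣⋃∣≡length disj ∣T∣≡1))

⋃≡∁⋃⇒separated : ∀ {n} {T R : FinSet n} {x A B} → ⋃ R ≡ ∁ (⋃ T) →
  A Membership.∈ T → x ∈ A → B Membership.∈ R → x ∉ B
⋃≡∁⋃⇒separated ⋃R≡∁⋃T A∈T x∈A B∈R x∈B =
  Subset.x∈∁p⇒x∉p (subst (_ ∈_) ⋃R≡∁⋃T (∈-⋃⁺ x∈B B∈R)) (∈-⋃⁺ x∈A A∈T)

IsPartition-++⁺ : ∀ {n} {T R : FinSet n} {k} → IsPartialPartition T → IsPartitionOf (∁ (⋃ T)) k R →
  IsPartition n (length T + k) (T ++ R)
IsPartition-++⁺ {T = T} {R} (uniqT , neT , disjT) (uniqR , len , neR , disjR , ⋃R≡) =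
  Unique.++⁺ uniqT uniqR (λ { (A∈T , A∈R) → let x , x∈A = All.lookup neT A∈T in separated A∈T x∈A A∈R x∈A }) ,
  ≡-trans (List.length-++ T) (cong (length T +_) len) ,
  All.++⁺ neT neR ,
  AllPairs.++⁺ disjT disjR (All.tabulate λ A∈T → All.tabulate λ B∈R (x , x∈A∩B) →
    separated A∈T (proj₁ (Subset.x∈p∩q⁻ _ _ x∈A∩B)) B∈R (proj₂ (Subset.x∈p∩q⁻ _ _ x∈A∩B))) ,
  ≡-trans (⋃-++ T R) (≡-trans (cong (⋃ T ∪_) ⋃R≡) (Subset.p∪∁p≡⊤ (⋃ T)))
  where
  separated : ∀ {x A B} → A Membership.∈ T → x ∈ A → B Membership.∈ R → x ∉ B
  separated = ⋃≡∁⋃⇒separated ⋃R≡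

IsPartition-split : ∀ {n r} {T X : FinSet n} → IsPartition n r X → Unique T → T ⊆ₛ X →
  ∃ λ R → X ↭ T ++ R × IsPartialPartition T × IsPartitionOf (∁ (⋃ T)) (r ∸ length T) R
IsPartition-split {r = r} {T} {X} P uniqT T⊆X with Unique-⊆⇒↭++ uniqT T⊆X
... | R , X↭T++R with IsPartitionOf-resp-↭ X↭T++R P
... | uniq , len , ne , disj , ⋃≡⊤ with AllPairs-++⁻ T uniq | All.++⁻ T ne | AllPairs-++⁻ T disj
... | _ , uniqR , _ | neT , neR | disjT , disjR , T#R =
  R , X↭T++R , (uniqT , neT , disjT) , uniqR ,
  ≡-trans (sym (m+n∸m≡n (length T) (length R))) (cong (_∸ length T) (≡-trans (sym (List.length-++ T)) len)) ,
  neR , disjR , Subset.⊆-antisym ⋃R⊆∁⋃T ∁⋃T⊆⋃R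
  where
  ⋃R⊆∁⋃T : ∀ {x} → x ∈ ⋃ R → x ∈ ∁ (⋃ T)
  ⋃R⊆∁⋃T {x} x∈⋃R = Subset.x∉p⇒x∈∁p λ x∈⋃T → separated (∈-⋃⁻ T x∈⋃T) (∈-⋃⁻ R x∈⋃R)
    where
    separated : (∃ λ A → A Membership.∈ T × x ∈ A) → ¬ (∃ λ B → B Membership.∈ R × x ∈ B)
    separated (A , A∈T , x∈A) (B , B∈R , x∈B) =
      All.lookup (All.lookup T#R A∈T) B∈R (x , Subset.x∈p∩q⁺ (x∈A , x∈B))
  ∁⋃T⊆⋃R : ∀ {x} → x ∈ ∁ (⋃ T) → x ∈ ⋃ R
  ∁⋃T⊆⋃R {x} x∈∁⋃T
    with Subset.x∈p∪q⁻ (⋃ T) (⋃ R) (subst (x ∈_) (≡-trans (sym ⋃≡⊤) (⋃-++ T R)) Subset.∈⊤)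
  ... | inj₁ x∈⋃T = ⊥-elim (Subset.x∈∁p⇒x∉p x∈∁⋃T x∈⋃T)
  ... | inj₂ x∈⋃R = x∈⋃R

countExtensions : ∀ {n} {T : FinSet n} {k m} → IsPartialPartition T →
  CountIs (IsPartitionOf (∁ (⋃ T)) k) m → CountPT n (length T + k) T m
countExtensions {n} {T} {k} T-pp (f , fP , f-inj , f-surj) =
  (λ i → T ++ f i) ,
  (λ i → IsPartition-++⁺ T-pp (fP i) , All.tabulate Membership.∈-++⁺ˡ) ,
  (λ i j p → f-inj i j (++-cancelˡ-↭ T p)) ,
  λ X (P , T⊆X) → surjective X P T⊆X
  where
  surjective : ∀ X → IsPartition n (length T + k) X → T ⊆ₛ X → ∃ λ i → X ↭ T ++ f i
  surjective X P T⊆X with IsPartition-split P (proj₁ T-pp) T⊆X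
  ... | R , X↭T++R , _ , PR with f-surj R (subst (λ k′ → IsPartitionOf _ k′ R) (m+n∸m≡n (length T) k) PR)
  ... | i , R↭ = i , ↭-trans X↭T++R (++⁺ˡ T R↭)

CountIs-↭++-≤ : ∀ {n} {P Q : FinSet n → Set} {k m} (T : FinSet n) →
  (∀ X → P X → ∃ λ Y → X ↭ T ++ Y × Q Y) → CountIs P k → CountIs Q m → k ≤ m
CountIs-↭++-≤ {Q = Q} {k} {m} T split (f , fP , f-inj , _) (g , _ , _ , g-surj) =
  Fin.injective⇒≤ index-injective
  where
  rest : ∀ i → ∃ λ Y → f i ↭ T ++ Y × Q Y
  rest i = split (f i) (fP i)
  index : Fin k → Fin m
  index i = proj₁ (g-surj (proj₁ (rest i)) (proj₂ (proj₂ (rest i))))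
  f↭T++g∘index : ∀ i → f i ↭ T ++ g (index i)
  f↭T++g∘index i =
    ↭-trans (proj₁ (proj₂ (rest i))) (++⁺ˡ T (proj₂ (g-surj (proj₁ (rest i)) (proj₂ (proj₂ (rest i))))))
  index-injective : ∀ {i j} → index i ≡ index j → i ≡ j
  index-injective {i} {j} eq = f-inj i j
    (↭-trans (f↭T++g∘index i) (subst (λ l → T ++ g l ↭ f j) (sym eq) (↭-sym (f↭T++g∘index j))))

CountPT-≤ : ∀ n r q → q < r → (T : FinSet n) → IsQSet q T → (k : ℕ) → CountPT n r T k →
  k ≤ S (n ∸ q) (r ∸ q)
CountPT-≤ n r q q<r T (uniq , refl) zero    _              = z≤n
CountPT-≤ n r q q<r T (uniq , refl) (suc k) c@(f , fP , _)
  with IsPartition-split (proj₁ (fP zero)) uniq (proj₂ (fP zero))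
... | _ , _ , T-pp , _ = begin
  suc k              ≤⟨ CountIs-↭++-≤ T split c (countPartitionsOf C K) ⟩
  S ∣ C ∣ K          ≤⟨ subst (λ K → S ∣ C ∣ K ≤ S (n ∸ length T) K) (sym K≡1+) (S-monoˡ-≤ _ ∣C∣≤) ⟩
  S (n ∸ length T) K ∎
  where
  open Data.Nat.Properties.≤-Reasoning
  C = ∁ (⋃ T)
  K = r ∸ length T
  K≡1+ : K ≡ suc (r ∸ suc (length T))
  K≡1+ = +-∸-assoc 1 q<r
  split : ∀ X → IsPartition n r X × T ⊆ₛ X → ∃ λ Y → X ↭ T ++ Y × IsPartitionOf C K Y
  split X (P , T⊆X) with IsPartition-split P uniq T⊆X
  ... | R , X↭T++R , _ , PR = R , X↭T++R , PR
  ∣C∣≤ : ∣ C ∣ ≤ n ∸ length T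
  ∣C∣≤ = ≤-trans (≤-reflexive (Subset.∣∁p∣≡n∸∣p∣ (⋃ T))) (∸-monoʳ-≤ n (length≤∣⋃∣ T-pp))

singletons : ∀ {n} q → q ≤ n → FinSet n
singletons q q≤n = tabulate (λ (i : Fin q) → ⁅ inject≤ i q≤n ⁆)

singletons-isPartialPartition : ∀ {n} q (q≤n : q ≤ n) → IsPartialPartition (singletons q q≤n)
singletons-isPartialPartition q q≤n =
  Unique.tabulate⁺ (λ {i} {j} → inject≤-injective i j ∘ ⁅⁆-injective) ,
  All.tabulate⁺ (λ i → _ , Subset.x∈⁅x⁆ _) ,
  AllPairs.tabulate⁺ (λ {i} {j} i≢j → ≢⇒Disjoint-⁅⁆ (i≢j ∘ inject≤-injective i j))
  where
  inject≤-injective : ∀ i j → inject≤ i q≤n ≡ inject≤ j q≤n → i ≡ j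
  inject≤-injective = Fin.inject≤-injective q≤n q≤n

∣∁⋃singletons∣ : ∀ {n} q (q≤n : q ≤ n) → ∣ ∁ (⋃ (singletons q q≤n)) ∣ ≡ n ∸ q
∣∁⋃singletons∣ {n} q q≤n = begin
  ∣ ∁ (⋃ T) ∣   ≡⟨ Subset.∣∁p∣≡n∸∣p∣ (⋃ T) ⟩
  n ∸ ∣ ⋃ T ∣   ≡⟨ cong (n ∸_) (∣⋃∣≡length T-disj ∣T∣≡1) ⟩
  n ∸ length T  ≡⟨ cong (n ∸_) (List.length-tabulate block) ⟩
  n ∸ q         ∎
  where
  open ≡-Reasoning
  block : Fin q → Subset n
  block i = ⁅ inject≤ i q≤n ⁆
  T = singletons q q≤n
  T-disj : AllPairs Disjoint T
  T-disj = proj₂ (proj₂ (singletons-isPartialPartition q q≤n))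
  ∣T∣≡1 : All (λ A → ∣ A ∣ ≡ 1) T
  ∣T∣≡1 = All.tabulate⁺ {f = block} (λ i → Subset.∣⁅x⁆∣≡1 (inject≤ i q≤n))

LIs-S : ∀ n r q → q < r → q ≤ n → LIs n r q (S (n ∸ q) (r ∸ q))
LIs-S n r q q<r q≤n = (T , (proj₁ T-pp , List.length-tabulate _) , count) , CountPT-≤ n r q q<r
  where
  T = singletons q q≤n
  T-pp = singletons-isPartialPartition q q≤n
  count : CountPT n r T (S (n ∸ q) (r ∸ q))
  count = subst₂ (λ r′ m → CountPT n r′ T m)
    (≡-trans (cong (_+ (r ∸ q)) (List.length-tabulate _)) (m+[n∸m]≡n (<⇒≤ q<r)))
    (cong (λ N → S N (r ∸ q)) (∣∁⋃singletons∣ q q≤n))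
    (countExtensions T-pp (countPartitionsOf (∁ (⋃ T)) (r ∸ q)))

lemma4p14 : (n r t : ℕ) → 2 ≤ suc t → suc t < r → r < n →
    ∃₂ λ a b → LIs n r t a × LIs n r (suc t) b ×
      (n ∸ suc t) * b ≤ (r ∸ suc t) * a
lemma4p14 n r t _ t+1<r r<n =
  S (n ∸ t) (r ∸ t) , S (n ∸ suc t) (r ∸ suc t) ,
  LIs-S n r t (<-trans (n<1+n t) t+1<r) (<⇒≤ t+1≤n) ,
  LIs-S n r (suc t) t+1<r t+1≤n ,
  subst₂ (λ a b → (n ∸ suc t) * S (n ∸ suc t) (r ∸ suc t) ≤ (r ∸ suc t) * S a b)
    (sym (+-∸-assoc 1 t+1≤n)) (sym (+-∸-assoc 1 (<⇒≤ t+1<r)))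
    (m*S[m,j]≤j*S[1+m,1+j] (n ∸ suc t) (r ∸ suc t))
  where
  t+1≤n : suc t ≤ n
  t+1≤n = <⇒≤ (<-trans t+1<r r<n)
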